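{- For any $f\in{}^\omega\omega$, $\{f\}\le_{\mathsf s}\{f\}^+$, and for any $P\subseteq{}^\omega\omega$, if $\{f\}<_{\mathsf s}P$ then $\{f\}^+\le_{\mathsf s}P$. Here $\{f\}^+:=\{(a)^\frown g: g\in{}^\omega\omega,\ \{a\}^g=f,\ g\not\le_T f\}$. Thus $\deg_{\mathsf s}(\{f\}^+)$ is the immediate successor of $\deg_{\mathsf s}(\{f\})$ in $\mathbb{D}_{\mathsf s}$.
   Context: $(\{a\})_{a\in\omega}$ is a standard indexing of the partial recursive functionals; $\{a\}^g=f$ means the functional with index $a$ applied to oracle $g$ is total and equals $f$. $(a)^\frown g$ is the function with value $a$ at $0$ and $g(i-1)$ at $i\ge1$. $\le_T$ is Turing reducibility. For $P,Q\subseteq{}^\omega\omega$, $P\le_{\mathsf s}Q$ iff there is a partial recursive functional $\Phi$ such that for every $g\in Q$, $\Phi(g)$ is total and in $P$; $P<_{\mathsf s}Q$ means $P\le_{\mathsf s}Q$ and $Q\not\le_{\mathsf s}P$. $\mathbb{D}_{\mathsf s}$ is the partial order of equivalence classes (strong degrees) under mutual $\le_{\mathsf s}$-reducibility. -}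

module Defs where

open import Data.Nat using (ℕ; zero; suc; _+_; _<_)
open import Data.List using (List; []; _∷_; lookup; length)
open import Data.Fin using (Fin)
open import Data.Product using (Σ; ∃; _×_; _,_)
open import Relation.Nullary using (¬_)
open import Relation.Binary.PropositionalEquality using (_≡_)

-- Codes for partial recursive functionals (Kleene μ-recursion relative
-- to a unary oracle g : ℕ → ℕ).  Codes are untyped; a code applied to an
-- argument list of the wrong shape simply has no value (diverges).

data Code : Set where
  Zc    : Code
  Sc    : Code
  Pc    : ℕ → Code
  Oc    : Code
  Comp  : Code → List Code → Code
  Prec  : Code → Code → Code
  Mu    : Code → Code

data Lookup : List ℕ → ℕ → ℕ → Set where
  here  : ∀ {x xs} → Lookup (x ∷ xs) zero x
  there : ∀ {x xs i y} → Lookup xs i y → Lookup (x ∷ xs) (suc i) y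

mutual
  data Eval (g : ℕ → ℕ) : Code → List ℕ → ℕ → Set where
    ev-Z    : ∀ {xs} → Eval g Zc xs 0
    ev-S    : ∀ {x xs} → Eval g Sc (x ∷ xs) (suc x)
    ev-P    : ∀ {i xs y} → Lookup xs i y → Eval g (Pc i) xs y
    ev-O    : ∀ {x xs} → Eval g Oc (x ∷ xs) (g x)
    ev-Comp : ∀ {c ds xs ys y} → EvalList g ds xs ys → Eval g c ys y →
              Eval g (Comp c ds) xs y
    ev-Prec0 : ∀ {c d xs y} → Eval g c xs y → Eval g (Prec c d) (zero ∷ xs) y
    ev-PrecS : ∀ {c d n xs r y} → Eval g (Prec c d) (n ∷ xs) r →
               Eval g d (n ∷ r ∷ xs) y → Eval g (Prec c d) (suc n ∷ xs) y
    ev-Mu   : ∀ {c xs n} → Eval g c (n ∷ xs) 0 →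
              (∀ m → m < n → Σ ℕ λ k → Eval g c (m ∷ xs) (suc k)) →
              Eval g (Mu c) xs n

  data EvalList (g : ℕ → ℕ) : List Code → List ℕ → List ℕ → Set where
    evl-[] : ∀ {xs} → EvalList g [] xs []
    evl-∷  : ∀ {d ds xs y ys} → Eval g d xs y → EvalList g ds xs ys →
             EvalList g (d ∷ ds) xs (y ∷ ys)

-- Gödel numbering of codes (Cantor pairing); this gives the indexing
-- (a ↦ {a}): index a denotes the code c with encode c ≡ a, and indices
-- that encode no code denote the nowhere-defined functional.

tri : ℕ → ℕ
tri zero    = zero
tri (suc n) = suc n + tri n

pair : ℕ → ℕ → ℕ
pair x y = tri (x + y) + y

mutual
  encode : Code → ℕ
  encode Zc         = pair 0 0
  encode Sc         = pair 1 0
  encode (Pc i)     = pair 2 i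
  encode Oc         = pair 3 0
  encode (Comp c ds) = pair 4 (pair (encode c) (encodeList ds))
  encode (Prec c d) = pair 5 (pair (encode c) (encode d))
  encode (Mu c)     = pair 6 (encode c)

  encodeList : List Code → ℕ
  encodeList []       = 0
  encodeList (d ∷ ds) = suc (pair (encode d) (encodeList ds))

_^_≃_ : ℕ → (ℕ → ℕ) → (ℕ → ℕ) → Set
a ^ g ≃ f = Σ Code λ c → encode c ≡ a × (∀ n → Eval g c (n ∷ []) (f n))

_≤T_ : (ℕ → ℕ) → (ℕ → ℕ) → Set
g ≤T f = ∃ λ a → a ^ f ≃ g

_⌢_ : ℕ → (ℕ → ℕ) → (ℕ → ℕ)
(a ⌢ g) zero    = a
(a ⌢ g) (suc i) = g i

Subset : Set₁
Subset = (ℕ → ℕ) → Set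

_≤s_ : Subset → Subset → Set
P ≤s Q = ∃ λ e → ∀ g → Q g → ∃ λ h → (e ^ g ≃ h) × P h

_<s_ : Subset → Subset → Set
P <s Q = (P ≤s Q) × ¬ (Q ≤s P)

-- {f}  (membership up to pointwise equality)
⟦_⟧ : (ℕ → ℕ) → Subset
⟦ f ⟧ h = ∀ n → h n ≡ f n

_⁺ : (ℕ → ℕ) → Subset
(f ⁺) h = ∃ λ a → ∃ λ g → (∀ n → h n ≡ (a ⌢ g) n) × (a ^ g ≃ f) × ¬ (g ≤T f)

module Submission where

open import Defs
open import Data.Nat using (ℕ; zero; suc; _+_; _∸_; _≤_; _<_; z≤n; s≤s; pred)
open import Data.Nat.Properties
open import Data.Product using (Σ; ∃; _×_; _,_; proj₁; proj₂)
open import Data.Sum using (inj₁; inj₂)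
open import Data.List using (List; []; _∷_)
open import Data.Vec using (Vec; []; _∷_; toList; lookup)
open import Data.Fin using (Fin; toℕ; #_) renaming (zero to fzero; suc to fsuc)
open import Function using (_∘_)
open import Relation.Nullary using (¬_; contradiction)
open import Relation.Binary using (tri<; tri≈; tri>)
open import Relation.Binary.Construct.Closure.ReflexiveTransitive using (Star; ε; _◅_; _◅◅_)
open import Relation.Binary.PropositionalEquality

-- A member (a)⌢g of {f}⁺ carries an index a with {a}^g = f, so one universal functional,
-- reading the index at position 0 and simulating it on the rest of the oracle, computes f
-- from every member: {f} ≤s {f}⁺. If e witnesses {f} ≤s P, then g ↦ (e)⌢g maps P into
-- {f}⁺, because a g ∈ P with g ≤T f would give P ≤s {f}. And {f}⁺ ≰s {f}, since the image
-- (a)⌢g of f would satisfy g ≤T f. The universal functional is an unbounded search for the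
-- halting time of an abstract machine whose transition function is primitive recursive.

natrec : ℕ → ℕ → (ℕ → ℕ → ℕ) → ℕ
natrec zero    z s = z
natrec (suc n) z s = s n (natrec n z s)

ifz : ℕ → ℕ → ℕ → ℕ
ifz zero    a b = a
ifz (suc _) a b = b

-- Cantor unpairing

tri-mono-≤ : ∀ {d e} → d ≤ e → tri d ≤ tri e
tri-mono-≤ {e = zero}  z≤n     = z≤n
tri-mono-≤ {zero}      _       = z≤n
tri-mono-≤ {suc d} {suc e} (s≤s d≤e) = +-mono-≤ (s≤s d≤e) (tri-mono-≤ d≤e)

OnDiagonal : ℕ → ℕ → Set
OnDiagonal d n = tri d ≤ n × n < tri (suc d)

OnDiagonal-unique : ∀ {d e n} → OnDiagonal d n → OnDiagonal e n → d ≡ e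
OnDiagonal-unique {d} {e} (lo₁ , hi₁) (lo₂ , hi₂) with <-cmp d e
... | tri< d<e _ _ = contradiction (≤-trans (tri-mono-≤ d<e) lo₂) (<⇒≱ hi₁)
... | tri≈ _ d≡e _ = d≡e
... | tri> _ _ e<d = contradiction (≤-trans (tri-mono-≤ e<d) lo₁) (<⇒≱ hi₂)

OnDiagonal-pair : ∀ x y → OnDiagonal (x + y) (pair x y)
OnDiagonal-pair x y = m≤m+n (tri (x + y)) y , hi
  where
  hi : pair x y < tri (suc (x + y))
  hi = subst (pair x y <_) (+-comm (tri (x + y)) (suc (x + y)))
         (+-monoʳ-< (tri (x + y)) (s≤s (m≤n+m y x)))

-- Opaque, like pair′, conf and nth below: the machine is written once over a Vocabulary
-- and read both in ℕ and as a compiled term; the two readings agree by refl, which is only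
-- checked in reasonable time if these functions never unfold.
opaque
  diag : ℕ → ℕ
  diag n = natrec n 0 (λ m d → ifz (tri (suc d) ∸ suc m) (suc d) d)

  π₂ : ℕ → ℕ
  π₂ n = n ∸ tri (diag n)

  π₁ : ℕ → ℕ
  π₁ n = diag n ∸ π₂ n

  diag-unfold : ∀ n → diag n ≡ natrec n 0 (λ m d → ifz (tri (suc d) ∸ suc m) (suc d) d)
  diag-unfold n = refl

  π₂-unfold : ∀ n → π₂ n ≡ n ∸ tri (diag n)
  π₂-unfold n = refl

  π₁-unfold : ∀ n → π₁ n ≡ diag n ∸ π₂ n
  π₁-unfold n = refl

  OnDiagonal-diag : ∀ n → OnDiagonal (diag n) n
  OnDiagonal-diag zero = z≤n , s≤s z≤n
  OnDiagonal-diag (suc n) with diag n | OnDiagonal-diag n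
  ... | d | lo , hi with tri (suc d) ∸ suc n in eq
  ... | zero  = m∸n≡0⇒m≤n eq , ≤-<-trans hi (m<n+m (tri (suc d)) {suc (suc d)} (s≤s z≤n))
  ... | suc _ = m≤n⇒m≤1+n lo , m∸n≢0⇒n<m (λ eq′ → 0≢1+n (trans (sym eq′) eq))

  diag-pair : ∀ x y → diag (pair x y) ≡ x + y
  diag-pair x y = OnDiagonal-unique (OnDiagonal-diag (pair x y)) (OnDiagonal-pair x y)

  π₂-pair : ∀ x y → π₂ (pair x y) ≡ y
  π₂-pair x y rewrite diag-pair x y = m+n∸m≡n (tri (x + y)) y

  π₁-pair : ∀ x y → π₁ (pair x y) ≡ x
  π₁-pair x y rewrite π₂-pair x y | diag-pair x y = m+n∸n≡m x y

  π₂≤diag : ∀ n → π₂ n ≤ diag n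
  π₂≤diag n with diag n | OnDiagonal-diag n
  ... | d | lo , hi = ≤-pred (subst (n ∸ tri d <_) (m+n∸m≡n (tri d) (suc d))
                        (∸-monoˡ-< (subst (n <_) (+-comm (suc d) (tri d)) hi) lo))

  pair-π₁-π₂ : ∀ n → pair (π₁ n) (π₂ n) ≡ n
  pair-π₁-π₂ n rewrite m∸n+n≡m (π₂≤diag n) = m+[n∸m]≡n (proj₁ (OnDiagonal-diag n))

-- Terms compiled to codes

Computable : ∀ {k} → (Vec ℕ k → ℕ) → Set
Computable {k} F = Σ Code λ c → ∀ o (ρ : Vec ℕ k) → Eval o c (toList ρ) (F ρ)

data Term (n : ℕ) : Set where
  var  : Fin n → Term n
  zeroᵗ  : Term n
  sucᵗ : Term n → Term n
  orcᵗ : Term n → Term n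
  recᵗ : Term n → Term n → Term (suc (suc n)) → Term n
  prim : ∀ {k} (F : Vec ℕ k → ℕ) → Computable F → Vec (Term n) k → Term n

mutual
  ⟦_⟧ᵗ : ∀ {n} → Term n → (ℕ → ℕ) → Vec ℕ n → ℕ
  ⟦ var i      ⟧ᵗ o ρ = lookup ρ i
  ⟦ zeroᵗ        ⟧ᵗ o ρ = 0
  ⟦ sucᵗ t     ⟧ᵗ o ρ = suc (⟦ t ⟧ᵗ o ρ)
  ⟦ orcᵗ t     ⟧ᵗ o ρ = o (⟦ t ⟧ᵗ o ρ)
  ⟦ recᵗ e z s ⟧ᵗ o ρ = natrec (⟦ e ⟧ᵗ o ρ) (⟦ z ⟧ᵗ o ρ) (λ m r → ⟦ s ⟧ᵗ o (m ∷ r ∷ ρ))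
  ⟦ prim F _ ts ⟧ᵗ o ρ = F (⟦ ts ⟧ᵗ* o ρ)

  ⟦_⟧ᵗ* : ∀ {n k} → Vec (Term n) k → (ℕ → ℕ) → Vec ℕ n → Vec ℕ k
  ⟦ []     ⟧ᵗ* o ρ = []
  ⟦ t ∷ ts ⟧ᵗ* o ρ = ⟦ t ⟧ᵗ o ρ ∷ ⟦ ts ⟧ᵗ* o ρ

projections : ℕ → ℕ → List Code
projections i zero    = []
projections i (suc n) = Pc i ∷ projections (suc i) n

mutual
  compile : ∀ {n} → Term n → Code
  compile (var i)          = Pc (toℕ i)
  compile zeroᵗ              = Zc
  compile (sucᵗ t)         = Comp Sc (compile t ∷ [])
  compile (orcᵗ t)         = Comp Oc (compile t ∷ [])
  compile {n} (recᵗ e z s) = Comp (Prec (compile z) (compile s)) (compile e ∷ projections 0 n)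
  compile (prim F (c , _) ts) = Comp c (compile* ts)

  compile* : ∀ {n k} → Vec (Term n) k → List Code
  compile* []       = []
  compile* (t ∷ ts) = compile t ∷ compile* ts

Lookup-lookup : ∀ {n} (ρ : Vec ℕ n) i → Lookup (toList ρ) (toℕ i) (lookup ρ i)
Lookup-lookup (x ∷ ρ) fzero    = here
Lookup-lookup (x ∷ ρ) (fsuc i) = there (Lookup-lookup ρ i)

projections-correct : ∀ o i xs {n} (ρ : Vec ℕ n) →
                      (∀ {j y} → Lookup (toList ρ) j y → Lookup xs (i + j) y) →
                      EvalList o (projections i n) xs (toList ρ)
projections-correct o i xs []      inside = evl-[]
projections-correct o i xs (x ∷ ρ) inside =
  evl-∷ (ev-P (subst (λ j → Lookup xs j x) (+-identityʳ i) (inside here)))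
        (projections-correct o (suc i) xs ρ
          (λ {j} {y} l → subst (λ k → Lookup xs k y) (+-suc i j) (inside (there l))))

mutual
  compile-correct : ∀ {n} (t : Term n) o ρ → Eval o (compile t) (toList ρ) (⟦ t ⟧ᵗ o ρ)
  compile-correct (var i)  o ρ = ev-P (Lookup-lookup ρ i)
  compile-correct zeroᵗ      o ρ = ev-Z
  compile-correct (sucᵗ t) o ρ = ev-Comp (evl-∷ (compile-correct t o ρ) evl-[]) ev-S
  compile-correct (orcᵗ t) o ρ = ev-Comp (evl-∷ (compile-correct t o ρ) evl-[]) ev-O
  compile-correct (recᵗ e z s) o ρ =
    ev-Comp (evl-∷ (compile-correct e o ρ) (projections-correct o 0 (toList ρ) ρ (λ l → l)))
            (recursion (⟦ e ⟧ᵗ o ρ))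
    where
    recursion : ∀ m → Eval o (Prec (compile z) (compile s)) (m ∷ toList ρ)
                             (natrec m (⟦ z ⟧ᵗ o ρ) (λ m r → ⟦ s ⟧ᵗ o (m ∷ r ∷ ρ)))
    recursion zero    = ev-Prec0 (compile-correct z o ρ)
    recursion (suc m) = ev-PrecS (recursion m) (compile-correct s o (m ∷ _ ∷ ρ))
  compile-correct (prim F (c , c-correct) ts) o ρ =
    ev-Comp (compile*-correct ts o ρ) (c-correct o (⟦ ts ⟧ᵗ* o ρ))

  compile*-correct : ∀ {n k} (ts : Vec (Term n) k) o ρ →
                     EvalList o (compile* ts) (toList ρ) (toList (⟦ ts ⟧ᵗ* o ρ))
  compile*-correct []       o ρ = evl-[]
  compile*-correct (t ∷ ts) o ρ = evl-∷ (compile-correct t o ρ) (compile*-correct ts o ρ)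

computable-by : ∀ {k} {F : Vec ℕ k → ℕ} (t : Term k) → (∀ o ρ → ⟦ t ⟧ᵗ o ρ ≡ F ρ) → Computable F
computable-by t t≡F = compile t , λ o ρ → subst (Eval o (compile t) (toList ρ)) (t≡F o ρ) (compile-correct t o ρ)

uncurry₁ : (ℕ → ℕ) → Vec ℕ 1 → ℕ
uncurry₁ f (x ∷ []) = f x

uncurry₂ : (ℕ → ℕ → ℕ) → Vec ℕ 2 → ℕ
uncurry₂ f (x ∷ y ∷ []) = f x y

uncurry₃ : (ℕ → ℕ → ℕ → ℕ) → Vec ℕ 3 → ℕ
uncurry₃ f (x ∷ y ∷ z ∷ []) = f x y z

uncurry₄ : (ℕ → ℕ → ℕ → ℕ → ℕ) → Vec ℕ 4 → ℕ
uncurry₄ f (x ∷ y ∷ z ∷ w ∷ []) = f x y z w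

call₁ : ∀ {n f} → Computable (uncurry₁ f) → Term n → Term n
call₁ {f = f} C t = prim (uncurry₁ f) C (t ∷ [])

call₂ : ∀ {n f} → Computable (uncurry₂ f) → Term n → Term n → Term n
call₂ {f = f} C t u = prim (uncurry₂ f) C (t ∷ u ∷ [])

call₃ : ∀ {n f} → Computable (uncurry₃ f) → Term n → Term n → Term n → Term n
call₃ {f = f} C t u v = prim (uncurry₃ f) C (t ∷ u ∷ v ∷ [])

call₄ : ∀ {n f} → Computable (uncurry₄ f) → Term n → Term n → Term n → Term n → Term n
call₄ {f = f} C t u v w = prim (uncurry₄ f) C (t ∷ u ∷ v ∷ w ∷ [])

opaque
  pair′ : ℕ → ℕ → ℕ
  pair′ = pair

  conf : ℕ → ℕ → ℕ → ℕ → ℕ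
  conf t a b c = pair t (pair a (pair b c))

  nth : ℕ → ℕ → ℕ
  nth l i = π₁ (pred (natrec i l (λ _ r → π₂ (pred r))))

  pair′-unfold : ∀ x y → pair′ x y ≡ pair x y
  pair′-unfold x y = refl

  conf-unfold : ∀ t a b c → conf t a b c ≡ pair′ t (pair′ a (pair′ b c))
  conf-unfold t a b c = refl

  nth-unfold : ∀ l i → nth l i ≡ π₁ (pred (natrec i l (λ _ r → π₂ (pred r))))
  nth-unfold l i = refl

pred-computable : Computable (uncurry₁ pred)
pred-computable = computable-by (recᵗ (var (# 0)) zeroᵗ (var (# 0))) λ { o (x ∷ []) → natrec-pred x }
  where
  natrec-pred : ∀ x → natrec x 0 (λ m _ → m) ≡ pred x
  natrec-pred zero    = refl
  natrec-pred (suc x) = refl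

+-computable : Computable (uncurry₂ _+_)
+-computable = computable-by (recᵗ (var (# 1)) (var (# 0)) (sucᵗ (var (# 1))))
                 λ { o (x ∷ y ∷ []) → natrec-+ x y }
  where
  natrec-+ : ∀ x y → natrec y x (λ _ r → suc r) ≡ x + y
  natrec-+ x zero    = sym (+-identityʳ x)
  natrec-+ x (suc y) = trans (cong suc (natrec-+ x y)) (sym (+-suc x y))

∸-computable : Computable (uncurry₂ _∸_)
∸-computable = computable-by (recᵗ (var (# 1)) (var (# 0)) (call₁ pred-computable (var (# 1))))
                 λ { o (x ∷ y ∷ []) → natrec-∸ x y }
  where
  natrec-∸ : ∀ x y → natrec y x (λ _ r → pred r) ≡ x ∸ y
  natrec-∸ x zero    = refl
  natrec-∸ x (suc y) = trans (cong pred (natrec-∸ x y)) (pred[m∸n]≡m∸[1+n] x y)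

tri-computable : Computable (uncurry₁ tri)
tri-computable = computable-by (recᵗ (var (# 0)) zeroᵗ (call₂ +-computable (sucᵗ (var (# 0))) (var (# 1))))
                   λ { o (x ∷ []) → natrec-tri x }
  where
  natrec-tri : ∀ x → natrec x 0 (λ m r → suc m + r) ≡ tri x
  natrec-tri zero    = refl
  natrec-tri (suc x) = cong (suc x +_) (natrec-tri x)

ifz-computable : Computable (uncurry₃ ifz)
ifz-computable = computable-by (recᵗ (var (# 0)) (var (# 1)) (var (# 4)))
                   λ { o (x ∷ a ∷ b ∷ []) → natrec-ifz x a b }
  where
  natrec-ifz : ∀ x a b → natrec x a (λ _ _ → b) ≡ ifz x a b
  natrec-ifz zero    a b = refl
  natrec-ifz (suc x) a b = refl

pair′-computable : Computable (uncurry₂ pair′)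
pair′-computable =
  computable-by (call₂ +-computable (call₁ tri-computable (call₂ +-computable (var (# 0)) (var (# 1)))) (var (# 1)))
    λ { o (x ∷ y ∷ []) → sym (pair′-unfold x y) }

conf-computable : Computable (uncurry₄ conf)
conf-computable =
  computable-by (call₂ pair′-computable (var (# 0)) (call₂ pair′-computable (var (# 1))
                  (call₂ pair′-computable (var (# 2)) (var (# 3)))))
    λ { o (t ∷ a ∷ b ∷ c ∷ []) → sym (conf-unfold t a b c) }

diag-computable : Computable (uncurry₁ diag)
diag-computable =
  computable-by (recᵗ (var (# 0)) zeroᵗ
                   (call₃ ifz-computable
                     (call₂ ∸-computable (call₁ tri-computable (sucᵗ (var (# 1)))) (sucᵗ (var (# 0))))
                     (sucᵗ (var (# 1)))
                     (var (# 1))))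
    λ { o (x ∷ []) → sym (diag-unfold x) }

π₂-computable : Computable (uncurry₁ π₂)
π₂-computable =
  computable-by (call₂ ∸-computable (var (# 0)) (call₁ tri-computable (call₁ diag-computable (var (# 0)))))
    λ { o (x ∷ []) → sym (π₂-unfold x) }

π₁-computable : Computable (uncurry₁ π₁)
π₁-computable =
  computable-by (call₂ ∸-computable (call₁ diag-computable (var (# 0))) (call₁ π₂-computable (var (# 0))))
    λ { o (x ∷ []) → sym (π₁-unfold x) }

nth-computable : Computable (uncurry₂ nth)
nth-computable =
  computable-by (call₁ π₁-computable (call₁ pred-computable
                  (recᵗ (var (# 1)) (var (# 0)) (call₁ π₂-computable (call₁ pred-computable (var (# 1)))))))
    λ { o (l ∷ i ∷ []) → sym (nth-unfold l i) }

numeralᵗ : ∀ {n} → ℕ → Term n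
numeralᵗ zero    = zeroᵗ
numeralᵗ (suc k) = sucᵗ (numeralᵗ k)

numeralᵗ-value : ∀ {n o} {ρ : Vec ℕ n} k → ⟦ numeralᵗ k ⟧ᵗ o ρ ≡ k
numeralᵗ-value zero    = refl
numeralᵗ-value (suc k) = cong suc (numeralᵗ-value k)

prependᵗ : ℕ → Term 1
prependᵗ a = recᵗ (var (# 0)) (numeralᵗ a) (orcᵗ (var (# 0)))

-- A machine evaluating codes

record Vocabulary (A : Set) : Set where
  field
    zeroᵛ  : A
    sucᵛ   : A → A
    predᵛ  : A → A
    ifzᵛ   : A → A → A → A
    pairᵛ  : A → A → A
    confᵛ  : A → A → A → A → A
    π₁ᵛ    : A → A
    π₂ᵛ    : A → A
    nthᵛ   : A → A → A
    queryᵛ : A → A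

ℕ-vocabulary : (ℕ → ℕ) → Vocabulary ℕ
ℕ-vocabulary g = record
  { zeroᵛ = 0 ; sucᵛ = suc ; predᵛ = pred ; ifzᵛ = ifz ; pairᵛ = pair′ ; confᵛ = conf
  ; π₁ᵛ = π₁ ; π₂ᵛ = π₂ ; nthᵛ = nth ; queryᵛ = g }

-- Terms are run with oracle a ⌢ g, so a query x of g is a query suc x of the oracle.
term-vocabulary : ∀ n → Vocabulary (Term n)
term-vocabulary n = record
  { zeroᵛ = zeroᵗ ; sucᵛ = sucᵗ ; predᵛ = call₁ pred-computable ; ifzᵛ = call₃ ifz-computable
  ; pairᵛ = call₂ pair′-computable ; confᵛ = call₄ conf-computable
  ; π₁ᵛ = call₁ π₁-computable ; π₂ᵛ = call₁ π₂-computable ; nthᵛ = call₂ nth-computable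
  ; queryᵛ = λ x → orcᵗ (sucᵗ x) }

-- A configuration  conf t a b k  is
--   t = 0 : the value a is returned to the continuation b (halted if b = 0);
--   t = 1 : the code a is to be evaluated on the argument list b, continuation k;
--   t = 2 : the code list a is to be evaluated on b, continuation k.
-- A continuation is 0 or suc (conf f a b k′), a frame f over a continuation k′:
--   f = 0 : apply the code a to the returned argument list;
--   f = 1 : evaluate the code list a on b, then prepend the returned value (frame 2);
--   f = 2 : prepend a to the returned list;
--   f = 3 : step of Prec: evaluate the code a on n ∷ r ∷ xs, where b = n ∷ xs and r is returned;
--   f = 4 : μ-search with the code a at b = m ∷ xs: return m on 0, otherwise try suc m.
-- Lists are encoded by [] = 0 and x ∷ l = suc (pair x l); codes are taken apart by π₁, π₂ along encode.
module Machine {A : Set} (V : Vocabulary A) where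
  open Vocabulary V

  num : ℕ → A
  num zero    = zeroᵛ
  num (suc k) = sucᵛ (num k)

  tag slot₁ slot₂ slot₃ : A → A
  tag   c = π₁ᵛ c
  slot₁ c = π₁ᵛ (π₂ᵛ c)
  slot₂ c = π₁ᵛ (π₂ᵛ (π₂ᵛ c))
  slot₃ c = π₂ᵛ (π₂ᵛ (π₂ᵛ c))

  cons : A → A → A
  cons x l = sucᵛ (pairᵛ x l)

  head tail : A → A
  head l = π₁ᵛ (predᵛ l)
  tail l = π₂ᵛ (predᵛ l)

  μ-try : A → A → A → A
  μ-try c l k = confᵛ (num 1) c l (sucᵛ (confᵛ (num 4) c l k))

  prec-recurse : A → A → A → A → A
  prec-recurse c d l k = confᵛ (num 1) c l (sucᵛ (confᵛ (num 3) d l k))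

  resume : A → A → A → A → A → A
  resume v f a b k =
    ifzᵛ f (confᵛ (num 1) a v k)
    (ifzᵛ (predᵛ f) (confᵛ (num 2) a b (sucᵛ (confᵛ (num 2) v zeroᵛ k)))
    (ifzᵛ (predᵛ (predᵛ f)) (confᵛ zeroᵛ (cons a v) k zeroᵛ)
    (ifzᵛ (predᵛ (predᵛ (predᵛ f))) (confᵛ (num 1) a (cons (head b) (cons v (tail b))) k)
    (ifzᵛ v (confᵛ zeroᵛ (head b) k zeroᵛ) (μ-try a (cons (sucᵛ (head b)) (tail b)) k)))))

  return : A → A → A → A
  return c v k = ifzᵛ k c (resume v (tag (predᵛ k)) (slot₁ (predᵛ k)) (slot₂ (predᵛ k)) (slot₃ (predᵛ k)))

  prec-step : A → A → A → A → A → A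
  prec-step c cd n xs k =
    ifzᵛ n (confᵛ (num 1) (π₁ᵛ cd) xs k) (prec-recurse c (π₂ᵛ cd) (cons (predᵛ n) xs) k)

  evaluate : A → A → A → A → A → A
  evaluate c t p xs k =
    ifzᵛ t (confᵛ zeroᵛ zeroᵛ k zeroᵛ)
    (ifzᵛ (predᵛ t) (confᵛ zeroᵛ (sucᵛ (head xs)) k zeroᵛ)
    (ifzᵛ (predᵛ (predᵛ t)) (confᵛ zeroᵛ (nthᵛ xs p) k zeroᵛ)
    (ifzᵛ (predᵛ (predᵛ (predᵛ t))) (confᵛ zeroᵛ (queryᵛ (head xs)) k zeroᵛ)
    (ifzᵛ (predᵛ (predᵛ (predᵛ (predᵛ t))))
      (confᵛ (num 2) (π₂ᵛ p) xs (sucᵛ (confᵛ zeroᵛ (π₁ᵛ p) zeroᵛ k)))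
    (ifzᵛ (predᵛ (predᵛ (predᵛ (predᵛ (predᵛ t))))) (prec-step c p (head xs) (tail xs) k)
    (μ-try p (cons zeroᵛ xs) k))))))

  evaluate-list : A → A → A → A
  evaluate-list ds xs k =
    ifzᵛ ds (confᵛ zeroᵛ zeroᵛ k zeroᵛ)
      (confᵛ (num 1) (π₁ᵛ (predᵛ ds)) xs (sucᵛ (confᵛ (num 1) (π₂ᵛ (predᵛ ds)) xs k)))

  dispatch : A → A → A → A → A → A
  dispatch c t a b k =
    ifzᵛ t (return c a b) (ifzᵛ (predᵛ t) (evaluate a (π₁ᵛ a) (π₂ᵛ a) b k) (evaluate-list a b k))

  step : A → A
  step c = dispatch c (tag c) (slot₁ c) (slot₂ c) (slot₃ c)

π₁-pair′ : ∀ x y → π₁ (pair′ x y) ≡ x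
π₁-pair′ x y = trans (cong π₁ (pair′-unfold x y)) (π₁-pair x y)

π₂-pair′ : ∀ x y → π₂ (pair′ x y) ≡ y
π₂-pair′ x y = trans (cong π₂ (pair′-unfold x y)) (π₂-pair x y)

encodeArgs : List ℕ → ℕ
encodeArgs []       = 0
encodeArgs (x ∷ xs) = suc (pair′ x (encodeArgs xs))

cong₄ : ∀ (F : ℕ → ℕ → ℕ → ℕ → ℕ) {a b c d a′ b′ c′ d′} →
        a ≡ a′ → b ≡ b′ → c ≡ c′ → d ≡ d′ → F a b c d ≡ F a′ b′ c′ d′
cong₄ F refl refl refl refl = refl

module Simulation (g : ℕ → ℕ) where
  open Machine (ℕ-vocabulary g) public

  _⟶_ : ℕ → ℕ → Set
  c ⟶ d = step c ≡ d

  _⟶*_ : ℕ → ℕ → Set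
  _⟶*_ = Star _⟶_

  infixr 5 _≡◅_
  _≡◅_ : ∀ {c c′ d} → c ≡ c′ → c′ ⟶* d → c ⟶* d
  refl ≡◅ r = r

  tag-conf : ∀ t a b k → tag (conf t a b k) ≡ t
  tag-conf t a b k rewrite conf-unfold t a b k = π₁-pair′ t _

  slot₁-conf : ∀ t a b k → slot₁ (conf t a b k) ≡ a
  slot₁-conf t a b k rewrite conf-unfold t a b k | π₂-pair′ t (pair′ a (pair′ b k)) = π₁-pair′ a _

  slot₂-conf : ∀ t a b k → slot₂ (conf t a b k) ≡ b
  slot₂-conf t a b k
    rewrite conf-unfold t a b k | π₂-pair′ t (pair′ a (pair′ b k)) | π₂-pair′ a (pair′ b k) = π₁-pair′ b k

  slot₃-conf : ∀ t a b k → slot₃ (conf t a b k) ≡ k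
  slot₃-conf t a b k
    rewrite conf-unfold t a b k | π₂-pair′ t (pair′ a (pair′ b k)) | π₂-pair′ a (pair′ b k) = π₂-pair′ b k

  step-conf : ∀ t a b k → step (conf t a b k) ≡ dispatch (conf t a b k) t a b k
  step-conf t a b k =
    cong₄ (dispatch (conf t a b k)) (tag-conf t a b k) (slot₁-conf t a b k) (slot₂-conf t a b k) (slot₃-conf t a b k)

  step-evaluate : ∀ t p xs k → step (conf 1 (pair t p) xs k) ≡ evaluate (pair t p) t p xs k
  step-evaluate t p xs k =
    trans (step-conf 1 (pair t p) xs k) (cong₂ (λ u v → evaluate (pair t p) u v xs k) (π₁-pair t p) (π₂-pair t p))

  step-return : ∀ v f a b k w → step (conf 0 v (suc (conf f a b k)) w) ≡ resume v f a b k
  step-return v f a b k w =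
    trans (step-conf 0 v (suc (conf f a b k)) w)
          (cong₄ (resume v) (tag-conf f a b k) (slot₁-conf f a b k) (slot₂-conf f a b k) (slot₃-conf f a b k))

  step-evaluate-list : ∀ ds xs k → step (conf 2 ds xs k) ≡ evaluate-list ds xs k
  step-evaluate-list = step-conf 2

  step-halted : ∀ v w → step (conf 0 v 0 w) ≡ conf 0 v 0 w
  step-halted v = step-conf 0 v 0

  head-cons : ∀ x l → head (cons x l) ≡ x
  head-cons = π₁-pair′

  tail-cons : ∀ x l → tail (cons x l) ≡ l
  tail-cons = π₂-pair′

  nth-Lookup : ∀ {xs i y} → Lookup xs i y → nth (encodeArgs xs) i ≡ y
  nth-Lookup {x ∷ xs} here = trans (nth-unfold _ 0) (π₁-pair′ x (encodeArgs xs))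
  nth-Lookup {x ∷ xs} {suc i} (there l) = begin
    nth (encodeArgs (x ∷ xs)) (suc i)                       ≡⟨ nth-unfold _ (suc i) ⟩
    π₁ (pred (natrec (suc i) (encodeArgs (x ∷ xs)) drop₁))  ≡⟨ cong (π₁ ∘ pred) (natrec-drop₁ i) ⟩
    π₁ (pred (natrec i (encodeArgs xs) drop₁))              ≡⟨ sym (nth-unfold (encodeArgs xs) i) ⟩
    nth (encodeArgs xs) i                                   ≡⟨ nth-Lookup l ⟩
    _                                                       ∎
    where
    open ≡-Reasoning
    drop₁ : ℕ → ℕ → ℕ
    drop₁ _ r = π₂ (pred r)
    natrec-drop₁ : ∀ j → natrec (suc j) (encodeArgs (x ∷ xs)) drop₁ ≡ natrec j (encodeArgs xs) drop₁
    natrec-drop₁ zero    = π₂-pair′ x (encodeArgs xs)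
    natrec-drop₁ (suc j) = cong (drop₁ j) (natrec-drop₁ j)

  mutual
    simulate : ∀ {c xs y} → Eval g c xs y → ∀ k → conf 1 (encode c) (encodeArgs xs) k ⟶* conf 0 y k 0
    simulate ev-Z k = step-evaluate 0 0 _ k ◅ ε
    simulate (ev-S {x} {xs}) k =
      step-evaluate 1 0 _ k ◅ cong (λ u → conf 0 (suc u) k 0) (head-cons x (encodeArgs xs)) ≡◅ ε
    simulate (ev-P l) k = step-evaluate 2 _ _ k ◅ cong (λ u → conf 0 u k 0) (nth-Lookup l) ≡◅ ε
    simulate (ev-O {x} {xs}) k =
      step-evaluate 3 0 _ k ◅ cong (λ u → conf 0 (g u) k 0) (head-cons x (encodeArgs xs)) ≡◅ ε
    simulate (ev-Comp {c} {ds} {xs} {ys} el e) k =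
      step-evaluate 4 (pair (encode c) (encodeList ds)) _ k ◅
      cong₂ (λ u v → conf 2 v (encodeArgs xs) (suc (conf 0 u 0 k))) (π₁-pair (encode c) _) (π₂-pair (encode c) _) ≡◅
      simulate-list el (suc (conf 0 (encode c) 0 k)) ◅◅
      step-return (encodeArgs ys) 0 (encode c) 0 k 0 ◅
      simulate e k
    simulate (ev-Prec0 {c} {d} {xs} e) k =
      step-evaluate 5 (pair (encode c) (encode d)) _ k ◅
      cong₂ (λ u v → prec-step (pair 5 (pair (encode c) (encode d))) (pair (encode c) (encode d)) u v k)
        (head-cons 0 (encodeArgs xs)) (tail-cons 0 (encodeArgs xs)) ≡◅
      cong (λ u → conf 1 u (encodeArgs xs) k) (π₁-pair (encode c) _) ≡◅
      simulate e k
    simulate (ev-PrecS {c} {d} {n} {xs} {r} e₁ e₂) k =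
      step-evaluate 5 (pair (encode c) (encode d)) _ k ◅
      cong₂ (λ u v → prec-step (pair 5 (pair (encode c) (encode d))) (pair (encode c) (encode d)) u v k)
        (head-cons (suc n) (encodeArgs xs)) (tail-cons (suc n) (encodeArgs xs)) ≡◅
      cong (λ u → prec-recurse (pair 5 (pair (encode c) (encode d))) u (encodeArgs (n ∷ xs)) k)
        (π₂-pair (encode c) _) ≡◅
      simulate e₁ _ ◅◅
      step-return r 3 (encode d) (encodeArgs (n ∷ xs)) k 0 ◅
      cong₂ (λ u v → conf 1 (encode d) (cons u (cons r v)) k)
        (head-cons n (encodeArgs xs)) (tail-cons n (encodeArgs xs)) ≡◅
      simulate e₂ k
    simulate (ev-Mu {c} {xs} {n} e₀ below) k =
      step-evaluate 6 (encode c) _ k ◅ simulate-μ e₀ below k n 0 (+-identityʳ n)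

    -- m is the argument being tried; the answer n lies d further on.
    simulate-μ : ∀ {c xs n} → Eval g c (n ∷ xs) 0 → (∀ m → m < n → Σ ℕ λ v → Eval g c (m ∷ xs) (suc v)) →
                 ∀ k d m → d + m ≡ n → μ-try (encode c) (encodeArgs (m ∷ xs)) k ⟶* conf 0 n k 0
    simulate-μ {c} {xs} e₀ below k zero m refl =
      simulate e₀ _ ◅◅
      step-return 0 4 (encode c) (encodeArgs (m ∷ xs)) k 0 ◅
      cong (λ u → conf 0 u k 0) (head-cons m (encodeArgs xs)) ≡◅ ε
    simulate-μ {c} {xs} e₀ below k (suc d) m d+m≡n
      with below m (subst (m <_) d+m≡n (s≤s (m≤n+m m d)))
    ... | v , e =
      simulate e _ ◅◅
      step-return (suc v) 4 (encode c) (encodeArgs (m ∷ xs)) k 0 ◅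
      cong₂ (λ u w → μ-try (encode c) (cons (suc u) w) k) (head-cons m (encodeArgs xs)) (tail-cons m (encodeArgs xs)) ≡◅
      simulate-μ e₀ below k d (suc m) (trans (+-suc d m) d+m≡n)

    simulate-list : ∀ {ds xs ys} → EvalList g ds xs ys → ∀ k →
                    conf 2 (encodeList ds) (encodeArgs xs) k ⟶* conf 0 (encodeArgs ys) k 0
    simulate-list evl-[] k = step-evaluate-list 0 _ k ◅ ε
    simulate-list (evl-∷ {d} {ds} {xs} {y} {ys} e el) k =
      step-evaluate-list (suc (pair (encode d) (encodeList ds))) _ k ◅
      cong₂ (λ u v → conf 1 u (encodeArgs xs) (suc (conf 1 v (encodeArgs xs) k)))
        (π₁-pair (encode d) _) (π₂-pair (encode d) _) ≡◅
      simulate e _ ◅◅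
      step-return y 1 (encodeList ds) (encodeArgs xs) k 0 ◅
      simulate-list el _ ◅◅
      step-return (encodeArgs ys) 2 y 0 k 0 ◅ ε

-- The universal functional

IsLeastZero : (ℕ → ℕ) → ℕ → Set
IsLeastZero p m = p m ≡ 0 × (∀ j → j < m → Σ ℕ λ v → p j ≡ suc v)

least-zero : ∀ p k → p k ≡ 0 → Σ ℕ λ m → m ≤ k × IsLeastZero p m
least-zero p k pk≡0 = scan k 0 (+-identityʳ k) (λ _ ())
  where
  scan : ∀ d m → d + m ≡ k → (∀ j → j < m → Σ ℕ λ v → p j ≡ suc v) → Σ ℕ λ m → m ≤ k × IsLeastZero p m
  scan d m d+m≡k below with p m in pm
  ... | zero  = m , subst (m ≤_) d+m≡k (m≤n+m m d) , pm , below
  scan zero    m refl        below | suc v = contradiction (trans (sym pm) pk≡0) λ ()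
  scan (suc d) m d+m≡k below | suc v = scan d (suc m) (trans (+-suc d m) d+m≡k) below′
    where
    below′ : ∀ j → j < suc m → Σ ℕ λ v → p j ≡ suc v
    below′ j j<1+m with m≤n⇒m<n∨m≡n (≤-pred j<1+m)
    ... | inj₁ j<m  = below j j<m
    ... | inj₂ refl = v , pm

module Steps (g : ℕ → ℕ) where
  open Simulation g

  steps : ℕ → ℕ → ℕ
  steps k c = natrec k c (λ _ → step)

  steps-step : ∀ k c → steps k (step c) ≡ steps (suc k) c
  steps-step zero    c = refl
  steps-step (suc k) c = cong step (steps-step k c)

  ⟶*⇒steps : ∀ {c d} → c ⟶* d → Σ ℕ λ k → steps k c ≡ d
  ⟶*⇒steps ε = 0 , refl
  ⟶*⇒steps {c} (c⟶ ◅ r) with ⟶*⇒steps r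
  ... | k , eq = suc k , trans (sym (steps-step k c)) (trans (cong (steps k) c⟶) eq)

  steps-+ : ∀ j m c → steps (j + m) c ≡ steps j (steps m c)
  steps-+ zero    m c = refl
  steps-+ (suc j) m c = cong step (steps-+ j m c)

  steps-fixed : ∀ {c} → step c ≡ c → ∀ j → steps j c ≡ c
  steps-fixed c-fixed zero    = refl
  steps-fixed c-fixed (suc j) = trans (cong step (steps-fixed c-fixed j)) c-fixed

  steps-stable : ∀ {c m k} → step (steps m c) ≡ steps m c → m ≤ k → steps k c ≡ steps m c
  steps-stable {c} {m} {k} fixed m≤k = begin
    steps k c                  ≡⟨ cong (λ i → steps i c) (sym (m∸n+n≡m m≤k)) ⟩
    steps (k ∸ m + m) c        ≡⟨ steps-+ (k ∸ m) m c ⟩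
    steps (k ∸ m) (steps m c)  ≡⟨ steps-fixed fixed (k ∸ m) ⟩
    steps m c                  ∎
    where open ≡-Reasoning

  busy : ℕ → ℕ
  busy c = tag c + slot₂ c

  conf-slots : ∀ c → conf (tag c) (slot₁ c) (slot₂ c) (slot₃ c) ≡ c
  conf-slots c = begin
    conf (π₁ c) (π₁ (π₂ c)) (π₁ (π₂ (π₂ c))) (π₂ (π₂ (π₂ c)))  ≡⟨ conf-unfold _ _ _ _ ⟩
    pair′ (π₁ c) (pair′ (π₁ (π₂ c)) (pair′ (π₁ (π₂ (π₂ c))) (π₂ (π₂ (π₂ c)))))
      ≡⟨ cong (pair′ (π₁ c)) (cong (pair′ (π₁ (π₂ c))) (pair′-π₁-π₂ (π₂ (π₂ c)))) ⟩
    pair′ (π₁ c) (pair′ (π₁ (π₂ c)) (π₂ (π₂ c)))  ≡⟨ cong (pair′ (π₁ c)) (pair′-π₁-π₂ (π₂ c)) ⟩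
    pair′ (π₁ c) (π₂ c)                           ≡⟨ pair′-π₁-π₂ c ⟩
    c                                             ∎
    where
    open ≡-Reasoning
    pair′-π₁-π₂ : ∀ n → pair′ (π₁ n) (π₂ n) ≡ n
    pair′-π₁-π₂ n = trans (pair′-unfold (π₁ n) (π₂ n)) (pair-π₁-π₂ n)

  busy≡0⇒step-fixed : ∀ {c} → busy c ≡ 0 → step c ≡ c
  busy≡0⇒step-fixed {c} busy≡0 = begin
    step c                                        ≡⟨ cong step (sym c≡) ⟩
    step (conf 0 (slot₁ c) 0 (slot₃ c))           ≡⟨ step-halted (slot₁ c) (slot₃ c) ⟩
    conf 0 (slot₁ c) 0 (slot₃ c)                  ≡⟨ c≡ ⟩
    c                                             ∎
    where
    open ≡-Reasoning
    c≡ : conf 0 (slot₁ c) 0 (slot₃ c) ≡ c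
    c≡ = trans (cong₂ (λ t b → conf t (slot₁ c) b (slot₃ c))
                 (sym (m+n≡0⇒m≡0 (tag c) busy≡0)) (sym (m+n≡0⇒n≡0 (tag c) busy≡0)))
               (conf-slots c)

-- Terms in the variables k, n: the configuration after k steps of the machine started
-- on the code read from the oracle at 0 and the argument list n ∷ [].
runᵗ : Term 2
runᵗ = recᵗ (var (# 0)) startᵗ (Machine.step (term-vocabulary 4) (var (# 1)))
  where
  open Vocabulary (term-vocabulary 2)
  open Machine (term-vocabulary 2)
  startᵗ : Term 2
  startᵗ = confᵛ (num 1) (orcᵗ zeroᵗ) (cons (var (# 1)) zeroᵗ) zeroᵗ

busyᵗ : Term 2
busyᵗ = call₂ +-computable (tag runᵗ) (slot₂ runᵗ)
  where open Machine (term-vocabulary 2)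

outputᵗ : Term 2
outputᵗ = slot₁ runᵗ
  where open Machine (term-vocabulary 2)

universal : Code
universal = Comp (compile outputᵗ) (Mu (compile busyᵗ) ∷ Pc 0 ∷ [])

module _ (a : ℕ) (g : ℕ → ℕ) (n : ℕ) where
  open Simulation g
  open Steps g

  start : ℕ
  start = conf 1 a (encodeArgs (n ∷ [])) 0

  runᵗ-steps : ∀ k → ⟦ runᵗ ⟧ᵗ (a ⌢ g) (k ∷ n ∷ []) ≡ steps k start
  runᵗ-steps zero    = refl
  runᵗ-steps (suc k) = cong step (runᵗ-steps k)

  universal-halts-at : ∀ {k y} → steps k start ≡ conf 0 y 0 0 →
                       Σ ℕ (λ m → m ≤ k × IsLeastZero (λ j → busy (steps j start)) m) →
                       Eval (a ⌢ g) universal (n ∷ []) y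
  universal-halts-at {k} {y} k-halts (m , m≤k , m-halts , below) =
    ev-Comp (evl-∷ (ev-Mu (busyᵗ-eval m m-halts) λ j j<m → proj₁ (below j j<m) , busyᵗ-eval j (proj₂ (below j j<m)))
                   (evl-∷ (ev-P here) evl-[]))
            (subst (Eval (a ⌢ g) (compile outputᵗ) (m ∷ n ∷ [])) output-m (compile-correct outputᵗ (a ⌢ g) (m ∷ n ∷ [])))
    where
    busyᵗ-eval : ∀ j {v} → busy (steps j start) ≡ v → Eval (a ⌢ g) (compile busyᵗ) (j ∷ n ∷ []) v
    busyᵗ-eval j eq = subst (Eval (a ⌢ g) (compile busyᵗ) (j ∷ n ∷ []))
                          (trans (cong busy (runᵗ-steps j)) eq) (compile-correct busyᵗ (a ⌢ g) (j ∷ n ∷ []))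
    output-m : ⟦ outputᵗ ⟧ᵗ (a ⌢ g) (m ∷ n ∷ []) ≡ y
    output-m = begin
      slot₁ (⟦ runᵗ ⟧ᵗ (a ⌢ g) (m ∷ n ∷ []))  ≡⟨ cong slot₁ (runᵗ-steps m) ⟩
      slot₁ (steps m start)                  ≡⟨ cong slot₁ (sym (steps-stable (busy≡0⇒step-fixed m-halts) m≤k)) ⟩
      slot₁ (steps k start)                  ≡⟨ cong slot₁ k-halts ⟩
      slot₁ (conf 0 y 0 0)                   ≡⟨ slot₁-conf 0 y 0 0 ⟩
      y                                      ∎
      where open ≡-Reasoning

  universal-halts : ∀ {y} → start ⟶* conf 0 y 0 0 → Eval (a ⌢ g) universal (n ∷ []) y
  universal-halts {y} start⟶*y = halts-within (⟶*⇒steps start⟶*y)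
    where
    halts-within : Σ ℕ (λ k → steps k start ≡ conf 0 y 0 0) → Eval (a ⌢ g) universal (n ∷ []) y
    halts-within (k , k-halts) =
      universal-halts-at k-halts (least-zero (λ j → busy (steps j start)) k
        (trans (cong busy k-halts) (cong₂ _+_ (tag-conf 0 y 0 0) (slot₂-conf 0 y 0 0))))

Eval-universal : ∀ {c g x y} → Eval g c (x ∷ []) y → Eval (encode c ⌢ g) universal (x ∷ []) y
Eval-universal {c} {g} {n} e = universal-halts (encode c) g n (Simulation.simulate g e 0)

-- Strong reducibility

mutual
  Eval-resp-≗ : ∀ {o o′ c xs y} → o ≗ o′ → Eval o c xs y → Eval o′ c xs y
  Eval-resp-≗ o≗o′ ev-Z = ev-Z
  Eval-resp-≗ o≗o′ ev-S = ev-S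
  Eval-resp-≗ o≗o′ (ev-P l) = ev-P l
  Eval-resp-≗ {o′ = o′} o≗o′ (ev-O {x} {xs}) = subst (Eval o′ Oc (x ∷ xs)) (sym (o≗o′ x)) ev-O
  Eval-resp-≗ o≗o′ (ev-Comp el e) = ev-Comp (EvalList-resp-≗ o≗o′ el) (Eval-resp-≗ o≗o′ e)
  Eval-resp-≗ o≗o′ (ev-Prec0 e) = ev-Prec0 (Eval-resp-≗ o≗o′ e)
  Eval-resp-≗ o≗o′ (ev-PrecS e₁ e₂) = ev-PrecS (Eval-resp-≗ o≗o′ e₁) (Eval-resp-≗ o≗o′ e₂)
  Eval-resp-≗ o≗o′ (ev-Mu e below) =
    ev-Mu (Eval-resp-≗ o≗o′ e) λ m m<n → proj₁ (below m m<n) , Eval-resp-≗ o≗o′ (proj₂ (below m m<n))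

  EvalList-resp-≗ : ∀ {o o′ ds xs ys} → o ≗ o′ → EvalList o ds xs ys → EvalList o′ ds xs ys
  EvalList-resp-≗ o≗o′ evl-[] = evl-[]
  EvalList-resp-≗ o≗o′ (evl-∷ e el) = evl-∷ (Eval-resp-≗ o≗o′ e) (EvalList-resp-≗ o≗o′ el)

≃-respˡ-≗ : ∀ {a g g′ h} → g ≗ g′ → a ^ g ≃ h → a ^ g′ ≃ h
≃-respˡ-≗ g≗g′ (c , c≡a , c-computes) = c , c≡a , λ n → Eval-resp-≗ g≗g′ (c-computes n)

≃-respʳ-≗ : ∀ {a g h h′} → h ≗ h′ → a ^ g ≃ h → a ^ g ≃ h′
≃-respʳ-≗ {g = g} h≗h′ (c , c≡a , c-computes) =
  c , c≡a , λ n → subst (Eval g c (n ∷ [])) (h≗h′ n) (c-computes n)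

universal-⌢ : ∀ {a g f} → a ^ g ≃ f → encode universal ^ (a ⌢ g) ≃ f
universal-⌢ (c , refl , c-computes) = universal , refl , λ n → Eval-universal (c-computes n)

prepend-⌢ : ∀ a g → encode (compile (prependᵗ a)) ^ g ≃ (a ⌢ g)
prepend-⌢ a g = compile (prependᵗ a) , refl , λ n →
  subst (Eval g (compile (prependᵗ a)) (n ∷ [])) (prependᵗ-⌢ n) (compile-correct (prependᵗ a) g (n ∷ []))
  where
  prependᵗ-⌢ : ∀ n → ⟦ prependᵗ a ⟧ᵗ g (n ∷ []) ≡ (a ⌢ g) n
  prependᵗ-⌢ zero    = numeralᵗ-value a
  prependᵗ-⌢ (suc n) = refl

tail-≤T : ∀ {f h} → h ≤T f → (λ n → h (suc n)) ≤T f
tail-≤T {f} (_ , c , refl , c-computes) =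
  encode shifted , shifted , refl ,
  λ n → ev-Comp (evl-∷ (ev-Comp (evl-∷ (ev-P here) evl-[]) ev-S) evl-[]) (c-computes (suc n))
  where
  shifted : Code
  shifted = Comp c (Comp Sc (Pc 0 ∷ []) ∷ [])

≤T-resp-≗ : ∀ {f h h′} → h ≗ h′ → h ≤T f → h′ ≤T f
≤T-resp-≗ h≗h′ (a , a^f≃h) = a , ≃-respʳ-≗ h≗h′ a^f≃h

≤T⇒≤s⟦⟧ : ∀ {P f g} → P g → g ≤T f → P ≤s ⟦ f ⟧
≤T⇒≤s⟦⟧ {g = g} g∈P (a , a^f≃g) = a , λ f′ f′≗f → g , ≃-respˡ-≗ (λ n → sym (f′≗f n)) a^f≃g , g∈P

⟦⟧≤s⁺ : ∀ f → ⟦ f ⟧ ≤s (f ⁺)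
⟦⟧≤s⁺ f = encode universal , λ where
  h (a , g , h≗a⌢g , a^g≃f , _) → f , ≃-respˡ-≗ (λ n → sym (h≗a⌢g n)) (universal-⌢ a^g≃f) , λ _ → refl

⁺≤s-above : ∀ f P → ⟦ f ⟧ <s P → (f ⁺) ≤s P
⁺≤s-above f P ((e , reduce) , P≰f) = encode (compile (prependᵗ e)) , λ g g∈P → prepend g g∈P (reduce g g∈P)
  where
  prepend : ∀ g → P g → (∃ λ h → (e ^ g ≃ h) × ⟦ f ⟧ h) → ∃ λ h → (encode (compile (prependᵗ e)) ^ g ≃ h) × (f ⁺) h
  prepend g g∈P (h , e^g≃h , h≗f) =
    e ⌢ g , prepend-⌢ e g , e , g , (λ _ → refl) , ≃-respʳ-≗ h≗f e^g≃h , λ g≤Tf → P≰f (≤T⇒≤s⟦⟧ g∈P g≤Tf)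

⁺≰s⟦⟧ : ∀ f → ¬ ((f ⁺) ≤s ⟦ f ⟧)
⁺≰s⟦⟧ f (e , reduce) with reduce f (λ _ → refl)
... | h , e^f≃h , a , g , h≗a⌢g , _ , g≰Tf =
  g≰Tf (≤T-resp-≗ (λ n → h≗a⌢g (suc n)) (tail-≤T (e , e^f≃h)))

mainTheorem4 : (f : ℕ → ℕ) →
    (⟦ f ⟧ ≤s (f ⁺)) ×
    ((P : Subset) → ⟦ f ⟧ <s P → (f ⁺) ≤s P) ×
    (⟦ f ⟧ <s (f ⁺))
mainTheorem4 f = ⟦⟧≤s⁺ f , ⁺≤s-above f , (⟦⟧≤s⁺ f , ⁺≰s⟦⟧ f)
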